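{- Let $\Gamma$ be an imprimitive finite simple graph on $n$ vertices. If $\mathrm{Aut}(\Gamma)$ has a factorizing block system, then $\Gamma$ is uniformly vertex-transitive.
   Context: Permutations of an $n$-element set are identified with $n\times n$ permutation matrices (entry $(u,v)$ is $1$ iff $\sigma(u)=v$); $J_n$ is the all-ones matrix; the Schur product is the entrywise product, and two permutations are orthogonal if their Schur product is zero. For a group $G$ acting on a set $X$ with $|X|=n$, $G$ is uniformly transitive if there is a subset $\{\sigma_1,\ldots,\sigma_n\}\subset G$ of size $n$ with $\sum_i\sigma_i=J_n$ (as matrices of the action); a graph $\Gamma$ is uniformly vertex-transitive if $\mathrm{Aut}(\Gamma)$ is uniformly transitive on $V(\Gamma)$. For $G$ acting transitively on $X$, a block is a subset $B\subset X$ with $gB=B$ or $gB\cap B=\emptyset$ for all $g\in G$; it is nontrivial if $1<|B|<|X|$; $G$ acts imprimitively if it has a nontrivial block. A graph is imprimitive if $\mathrm{Aut}(\Gamma)$ acts (transitively and) imprimitively on $V(\Gamma)$. The block system of a block $B$ is $\mathcal{B}=\{gB:g\in G\}$, a partition of $X$ into $m$ blocks of equal size $k$. The fixer $\mathrm{fix}_\Gamma(\mathcal{B})$ is the subgroup of $\mathrm{Aut}(\Gamma)$ fixing every block of $\mathcal{B}$ setwise, i.e. the kernel of the action $\mathrm{Aut}(\Gamma)\to\mathrm{Sym}(\mathcal{B})$. A nontrivial block system $\mathcal{B}$ of $\mathrm{Aut}(\Gamma)$ with $m$ blocks of size $k$ is factorizing if (i) $\mathrm{fix}_\Gamma(\mathcal{B})$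 contains $k$ elements which are pairwise orthogonal with respect to the Schur product, and (ii) $\mathrm{Aut}(\Gamma)/\mathrm{fix}_\Gamma(\mathcal{B})$ acts uniformly transitively on $\mathcal{B}$. -}

module Defs where

open import Data.Nat using (ℕ; _<_; _*_)
open import Data.Fin using (Fin)
open import Data.Fin.Subset using (Subset; _∈_; _∉_; ∣_∣)
open import Data.Fin.Permutation using (Permutation′; _⟨$⟩ʳ_; _⟨$⟩ˡ_; _∘ₚ_; flip)
open import Data.Bool using (Bool; true; false)
open import Data.Product using (Σ; ∃; ∃-syntax; _×_; _,_)
open import Data.Sum using (_⊎_)
open import Relation.Binary.PropositionalEquality using (_≡_; _≢_)
open import Relation.Nullary using (¬_)
open import Level using (0ℓ)

infix 3 _⇔_
_⇔_ : Set → Set → Set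
P ⇔ Q = (P → Q) × (Q → P)

record Graph (n : ℕ) : Set where
  field
    adj     : Fin n → Fin n → Bool
    adj-sym : ∀ u v → adj u v ≡ adj v u
    loopless : ∀ v → adj v v ≡ false
open Graph public

-- Permutations of Fin n (identified with permutation matrices:
-- entry (u,v) is 1 iff σ u ≡ v).
Perm : ℕ → Set
Perm n = Permutation′ n

IsAut : ∀ {n} → Graph n → Perm n → Set
IsAut Γ σ = ∀ u v → adj Γ (σ ⟨$⟩ʳ u) (σ ⟨$⟩ʳ v) ≡ adj Γ u v

ExactlyOne : ∀ {m} → (Fin m → Set) → Set
ExactlyOne {m} P = Σ (Fin m) λ i → P i × (∀ j → P j → j ≡ i)

-- Σ_i σ_i = J_n for a family of n permutations (as 0/1 matrices):
-- every entry (u,v) of the sum equals 1, i.e. exactly one i has σ_i(u) = v.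
SumIsJ : ∀ {n} → (Fin n → Perm n) → Set
SumIsJ {n} σ = ∀ (u v : Fin n) → ExactlyOne (λ i → σ i ⟨$⟩ʳ u ≡ v)

DistinctPerms : ∀ {n} → Perm n → Perm n → Set
DistinctPerms {n} σ τ = ∃[ u ] (σ ⟨$⟩ʳ u ≢ τ ⟨$⟩ʳ u)

UniformlyVertexTransitive : ∀ {n} → Graph n → Set
UniformlyVertexTransitive {n} Γ =
  Σ (Fin n → Perm n) λ σ →
    (∀ i → IsAut Γ (σ i)) ×
    (∀ i j → i ≢ j → DistinctPerms (σ i) (σ j)) ×
    SumIsJ σ

VertexTransitive : ∀ {n} → Graph n → Set
VertexTransitive {n} Γ = ∀ (u v : Fin n) → ∃[ g ] (IsAut Γ g × g ⟨$⟩ʳ u ≡ v)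

-- B is a block of Aut(Γ): for every g ∈ Aut(Γ), gB = B or gB ∩ B = ∅.
IsBlock : ∀ {n} → Graph n → Subset n → Set
IsBlock {n} Γ B = ∀ g → IsAut Γ g →
    (∀ (y : Fin n) → (y ∈ B ⇔ (g ⟨$⟩ˡ y) ∈ B))
  ⊎ (∀ (x : Fin n) → x ∈ B → (g ⟨$⟩ʳ x) ∉ B)

Nontrivial : ∀ {n} → Subset n → Set
Nontrivial {n} B = (1 < ∣ B ∣) × (∣ B ∣ < n)

Imprimitive : ∀ {n} → Graph n → Set
Imprimitive {n} Γ = VertexTransitive Γ × ∃[ B ] (IsBlock Γ B × Nontrivial B)

InImage : ∀ {n} → Perm n → Subset n → Fin n → Set
InImage h B y = (h ⟨$⟩ˡ y) ∈ B

-- u and v lie in the same block of the block system {hB : h ∈ Aut(Γ)}.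
SameBlock : ∀ {n} → Graph n → Subset n → Fin n → Fin n → Set
SameBlock Γ B u v = ∃[ h ] (IsAut Γ h × InImage h B u × InImage h B v)

InFixer : ∀ {n} → Graph n → Subset n → Perm n → Set
InFixer {n} Γ B g = IsAut Γ g ×
  (∀ h → IsAut Γ h → ∀ (y : Fin n) → (InImage h B y ⇔ InImage h B (g ⟨$⟩ˡ y)))

-- Schur product of σ and τ is zero.
Orthogonal : ∀ {n} → Perm n → Perm n → Set
Orthogonal {n} σ τ = ∀ (u : Fin n) → σ ⟨$⟩ʳ u ≢ τ ⟨$⟩ʳ u

-- Aut(Γ)/fix(𝓑) acts uniformly transitively on the m blocks of 𝓑:
-- there are m distinct cosets g_1 fix, …, g_m fix (g_i ∈ Aut(Γ)) whose
-- action matrices on 𝓑 sum to J_m, i.e. for all blocks C, D exactly one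
-- i has g_i C = D (C, D given by representatives u ∈ C, v ∈ D).
QuotientUniformlyTransitive : ∀ {n} → Graph n → Subset n → (m : ℕ) → Set
QuotientUniformlyTransitive {n} Γ B m =
  Σ (Fin m → Perm n) λ g →
    (∀ i → IsAut Γ (g i)) ×
    (∀ i j → i ≢ j → ¬ InFixer Γ B (g i ∘ₚ flip (g j))) ×
    (∀ (u v : Fin n) → ExactlyOne (λ i → SameBlock Γ B (g i ⟨$⟩ʳ u) v))

IsFactorizing : ∀ {n} → Graph n → Subset n → Set
IsFactorizing {n} Γ B =
  IsBlock Γ B × Nontrivial B ×
  (Σ (Fin ∣ B ∣ → Perm n) λ τ →
     (∀ i → InFixer Γ B (τ i)) × (∀ i j → i ≢ j → Orthogonal (τ i) (τ j))) ×
  -- (ii) with m the number of blocks (m · k = n)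
  (∀ m → m * ∣ B ∣ ≡ n → QuotientUniformlyTransitive Γ B m)

module Submission where

-- Let B be the block, k = |B|, and τ₁,…,τₖ the pairwise orthogonal elements
-- of the fixer.  Orthogonality says that j ↦ τⱼ(u) is injective; since each
-- τⱼ fixes every block hB and |hB| = k, the points τⱼ(u) fill the block of u.
-- So the τⱼ act sharply transitively on every block.  Choosing the least
-- point of each block as its representative, (r, j) ↦ τⱼ(xᵣ) is a bijection
-- Fin m × Fin k ≅ V(Γ), whence n = m k with m the number of blocks.  The
-- factorizing hypothesis then yields automorphisms g₁,…,gₘ permuting the
-- blocks sharply transitively, and the n automorphisms σᵢⱼ = gᵢ ∘ τⱼ satisfy
-- Σ σᵢⱼ = J: for u, v the index i is forced by the block of v, and then j by
-- the position of gᵢ⁻¹(v) in the block of u.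

open import Defs
open import Data.Nat using (ℕ)
open import Data.Product using (∃-syntax; _×_)

open import Data.Nat using (_*_)
open import Data.Nat.Properties using (<⇒≤; ≰⇒>; <⇒≱)
open import Data.Fin as F using (Fin; zero; suc; combine; remQuot; fromℕ<; inject)
open import Data.Fin.Properties
  using (_≟_; suc-injective; any?; all?; injective⇒≤; cantor-schröder-bernstein; combine-injective;
         combine-remQuot; remQuot-combine; ¬∀⟶∃¬-smallest; toℕ-injective; toℕ-inject;
         toℕ-fromℕ<)
  renaming (_≤?_ to _≤ᶠ?_; ≤-antisym to ≤ᶠ-antisym)
open import Data.Fin.Subset using (Subset; inside; outside; _∈_; ∣_∣; _-_)
open import Data.Fin.Subset.Properties using (_∈?_; x∈p∧x≢y⇒x∈p-y; x∈p⇒∣p-x∣<∣p∣)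
open import Data.Fin.Permutation using (_⟨$⟩ʳ_; _⟨$⟩ˡ_; _∘ₚ_; flip; inverseˡ; inverseʳ)
open import Data.Vec using (_∷_; tabulate; here; there)
open import Data.Vec.Properties using (lookup∘tabulate; []=⇒lookup; lookup⇒[]=)
open import Data.Bool using (true)
open import Data.Product using (_,_; proj₁; proj₂; uncurry)
open import Data.Sum using (inj₁; inj₂)
open import Function using (_∘_)
open import Function.Definitions using (Injective)
open import Relation.Nullary using (¬_; Dec; yes; no; does; contradiction; ¬?)
open import Relation.Nullary.Decidable using (dec-true; decidable-stable; _→-dec_)
open import Relation.Unary using (Decidable)
open import Relation.Binary.PropositionalEquality
  using (_≡_; _≢_; refl; sym; trans; cong; cong₂; subst; module ≡-Reasoning)

unrank : ∀ {n} (T : Subset n) → Fin ∣ T ∣ → Fin n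
unrank (inside  ∷ T) zero    = zero
unrank (inside  ∷ T) (suc r) = suc (unrank T r)
unrank (outside ∷ T) r       = suc (unrank T r)

unrank-∈ : ∀ {n} (T : Subset n) (r : Fin ∣ T ∣) → unrank T r ∈ T
unrank-∈ (inside  ∷ T) zero    = here
unrank-∈ (inside  ∷ T) (suc r) = there (unrank-∈ T r)
unrank-∈ (outside ∷ T) r       = there (unrank-∈ T r)

unrank-injective : ∀ {n} (T : Subset n) → Injective _≡_ _≡_ (unrank T)
unrank-injective (inside  ∷ T) {zero}  {zero}  _ = refl
unrank-injective (inside  ∷ T) {suc r} {suc s} e =
  cong suc (unrank-injective T (suc-injective e))
unrank-injective (outside ∷ T) e = unrank-injective T (suc-injective e)

rank : ∀ {n} (T : Subset n) (x : Fin n) → x ∈ T → Fin ∣ T ∣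
rank (inside  ∷ T) zero    here      = zero
rank (inside  ∷ T) (suc x) (there p) = suc (rank T x p)
rank (outside ∷ T) (suc x) (there p) = rank T x p

unrank-rank : ∀ {n} (T : Subset n) (x : Fin n) (p : x ∈ T) → unrank T (rank T x p) ≡ x
unrank-rank (inside  ∷ T) zero    here      = refl
unrank-rank (inside  ∷ T) (suc x) (there p) = cong suc (unrank-rank T x p)
unrank-rank (outside ∷ T) (suc x) (there p) = cong suc (unrank-rank T x p)

rank-injective : ∀ {n} (T : Subset n) {x y : Fin n} {p : x ∈ T} {q : y ∈ T} →
                 rank T x p ≡ rank T y q → x ≡ y
rank-injective T {x} {y} {p} {q} e = begin
  x                      ≡⟨ sym (unrank-rank T x p) ⟩
  unrank T (rank T x p)  ≡⟨ cong (unrank T) e ⟩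
  unrank T (rank T y q)  ≡⟨ unrank-rank T y q ⟩
  y                      ∎
  where open ≡-Reasoning

-- Pigeonhole: an injection from Fin |S| into S hits every element of S,
-- for otherwise it would inject Fin |S| into the smaller set S - y.
injection-onto : ∀ {n} (S : Subset n) (f : Fin ∣ S ∣ → Fin n) → Injective _≡_ _≡_ f →
                 (∀ i → f i ∈ S) → ∀ y → y ∈ S → ∃[ i ] f i ≡ y
injection-onto S f f-injective f∈S y y∈S with any? (λ i → f i ≟ y)
... | yes hit  = hit
... | no  miss = contradiction (injective⇒≤ rank∘f-injective) (<⇒≱ (x∈p⇒∣p-x∣<∣p∣ y∈S))
  where
  f∈S-y : ∀ i → f i ∈ S - y
  f∈S-y i = x∈p∧x≢y⇒x∈p-y (f∈S i) (λ fi≡y → miss (i , fi≡y))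
  rank∘f-injective : Injective _≡_ _≡_ (λ i → rank (S - y) (f i) (f∈S-y i))
  rank∘f-injective e = f-injective (rank-injective (S - y) e)

select : ∀ {n} {P : Fin n → Set} → Decidable P → Subset n
select P? = tabulate (does ∘ P?)

select-sound : ∀ {n} {P : Fin n → Set} (P? : Decidable P) {x} → x ∈ select P? → P x
select-sound P? {x} x∈ = witness (P? x) (trans (sym (lookup∘tabulate _ x)) ([]=⇒lookup x∈))
  where
  witness : ∀ {A : Set} (A? : Dec A) → does A? ≡ true → A
  witness (yes a) _ = a

select-complete : ∀ {n} {P : Fin n → Set} (P? : Decidable P) {x} → P x → x ∈ select P?
select-complete P? {x} p = lookup⇒[]= x _ (trans (lookup∘tabulate _ x) (dec-true (P? x) p))

Injective₂ : ∀ {m k} {A : Set} → (Fin m → Fin k → A) → Set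
Injective₂ f = ∀ {i j i′ j′} → f i j ≡ f i′ j′ → i ≡ i′ × j ≡ j′

flatten : ∀ {m k} {A : Set} → (Fin m → Fin k → A) → Fin (m * k) → A
flatten {m} {k} f t = uncurry f (remQuot {m} k t)

flatten-combine : ∀ {m k} {A : Set} (f : Fin m → Fin k → A) i j → flatten f (combine i j) ≡ f i j
flatten-combine f i j = cong (uncurry f) (remQuot-combine i j)

flatten-injective : ∀ {m k} {A : Set} {f : Fin m → Fin k → A} →
                    Injective₂ f → Injective _≡_ _≡_ (flatten f)
flatten-injective {m} {k} f-injective {t} {t′} e with f-injective e
... | i≡i′ , j≡j′ = begin
  t                                   ≡⟨ sym (combine-remQuot {m} k t) ⟩
  uncurry combine (remQuot {m} k t)   ≡⟨ cong₂ combine i≡i′ j≡j′ ⟩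
  uncurry combine (remQuot {m} k t′)  ≡⟨ combine-remQuot {m} k t′ ⟩
  t′                                  ∎
  where open ≡-Reasoning

uvt-from-product : ∀ {n m k} (Γ : Graph n) (σ : Fin m → Fin k → Perm n) → m * k ≡ n →
  (∀ i j → IsAut Γ (σ i j)) →
  (∀ u v → ∃[ i ] ∃[ j ] σ i j ⟨$⟩ʳ u ≡ v) →
  (∀ u → Injective₂ (λ i j → σ i j ⟨$⟩ʳ u)) →
  UniformlyVertexTransitive Γ
uvt-from-product Γ σ refl σ-aut σ-onto σ-injective =
  flatten σ , (λ _ → σ-aut _ _) , distinct , sum-is-J
  where
  at-injective : ∀ u → Injective _≡_ _≡_ (λ t → flatten σ t ⟨$⟩ʳ u)
  at-injective u = flatten-injective (σ-injective u)

  distinct : ∀ s t → s ≢ t → DistinctPerms (flatten σ s) (flatten σ t)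
  distinct s t s≢t = s , λ e → s≢t (at-injective s e)

  sum-is-J : SumIsJ (flatten σ)
  sum-is-J u v with σ-onto u v
  ... | i , j , σij≡v = combine i j , hit , λ t e → at-injective u (trans e (sym hit))
    where
    hit : flatten σ (combine i j) ⟨$⟩ʳ u ≡ v
    hit = trans (cong (λ ρ → ρ ⟨$⟩ʳ u) (flatten-combine σ i j)) σij≡v

⟨$⟩ʳ-injective : ∀ {n} (π : Perm n) → Injective _≡_ _≡_ (π ⟨$⟩ʳ_)
⟨$⟩ʳ-injective π {x} {y} e = begin
  x                  ≡⟨ sym (inverseˡ π) ⟩
  π ⟨$⟩ˡ (π ⟨$⟩ʳ x)  ≡⟨ cong (π ⟨$⟩ˡ_) e ⟩
  π ⟨$⟩ˡ (π ⟨$⟩ʳ y)  ≡⟨ inverseˡ π ⟩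
  y                  ∎
  where open ≡-Reasoning

⟨$⟩ˡ-injective : ∀ {n} (π : Perm n) → Injective _≡_ _≡_ (π ⟨$⟩ˡ_)
⟨$⟩ˡ-injective π = ⟨$⟩ʳ-injective (flip π)

module Automorphisms {n} (Γ : Graph n) where

  IsAut-flip : ∀ g → IsAut Γ g → IsAut Γ (flip g)
  IsAut-flip g g-aut u v = begin
    adj Γ (g ⟨$⟩ˡ u) (g ⟨$⟩ˡ v)                        ≡⟨ sym (g-aut _ _) ⟩
    adj Γ (g ⟨$⟩ʳ (g ⟨$⟩ˡ u)) (g ⟨$⟩ʳ (g ⟨$⟩ˡ v))      ≡⟨ cong₂ (adj Γ) (inverseʳ g) (inverseʳ g) ⟩
    adj Γ u v                                          ∎
    where open ≡-Reasoning

  IsAut-∘ : ∀ g h → IsAut Γ g → IsAut Γ h → IsAut Γ (g ∘ₚ h)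
  IsAut-∘ g h g-aut h-aut u v = trans (h-aut (g ⟨$⟩ʳ u) (g ⟨$⟩ʳ v)) (g-aut u v)

image-transport : ∀ {n} (B : Subset n) (h g : Perm n) {z} →
                  InImage h B z → InImage (h ∘ₚ g) B (g ⟨$⟩ʳ z)
image-transport B h g z∈hB = subst (λ w → h ⟨$⟩ˡ w ∈ B) (sym (inverseˡ g)) z∈hB

module Blocks {n} (Γ : Graph n) (B : Subset n) (blk : IsBlock Γ B) where

  open Automorphisms Γ public

  images-coincide : ∀ h h′ → IsAut Γ h → IsAut Γ h′ → ∀ {x} →
                    InImage h B x → InImage h′ B x → ∀ {z} → InImage h B z → InImage h′ B z
  images-coincide h h′ h-aut h′-aut {x} x∈hB x∈h′B {z} z∈hB
    with blk (h′ ∘ₚ flip h) (IsAut-∘ h′ (flip h) h′-aut (IsAut-flip h h-aut))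
  ... | inj₁ fixes-B   = subst (λ w → h′ ⟨$⟩ˡ w ∈ B) (inverseʳ h) (proj₁ (fixes-B (h ⟨$⟩ˡ z)) z∈hB)
  ... | inj₂ moves-B   = contradiction (subst (λ w → h ⟨$⟩ˡ w ∈ B) (sym (inverseʳ h′)) x∈hB)
                                       (moves-B (h′ ⟨$⟩ˡ x) x∈h′B)

  sameBlock-transport : ∀ g → IsAut Γ g → ∀ {x y} →
                        SameBlock Γ B x y → SameBlock Γ B (g ⟨$⟩ʳ x) (g ⟨$⟩ʳ y)
  sameBlock-transport g g-aut (h , h-aut , x∈hB , y∈hB) =
    h ∘ₚ g , IsAut-∘ h g h-aut g-aut , image-transport B h g x∈hB , image-transport B h g y∈hB

  -- A family of |B| pairwise orthogonal elements of the fixer acts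
  -- sharply transitively on every block.
  module OrthogonalFixerFamily (τ : Fin ∣ B ∣ → Perm n) (τ-fix : ∀ j → InFixer Γ B (τ j))
                               (τ-orth : ∀ i j → i ≢ j → Orthogonal (τ i) (τ j)) where

    τ-injective : ∀ u → Injective _≡_ _≡_ (λ j → τ j ⟨$⟩ʳ u)
    τ-injective u {i} {j} e with i ≟ j
    ... | yes i≡j = i≡j
    ... | no  i≢j = contradiction e (τ-orth i j i≢j u)

    τ-preserves-image : ∀ h → IsAut Γ h → ∀ j {y} → InImage h B y → InImage h B (τ j ⟨$⟩ʳ y)
    τ-preserves-image h h-aut j {y} y∈hB =
      proj₂ (proj₂ (τ-fix j) h h-aut (τ j ⟨$⟩ʳ y))
            (subst (λ w → InImage h B w) (sym (inverseˡ (τ j))) y∈hB)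

    -- The |B| distinct points τⱼ(u) of hB fill it (pulled back to B by h⁻¹).
    τ-transitive-on-image : ∀ h → IsAut Γ h → ∀ {u y} →
                            InImage h B u → InImage h B y → ∃[ j ] τ j ⟨$⟩ʳ u ≡ y
    τ-transitive-on-image h h-aut {u} {y} u∈hB y∈hB
      with injection-onto B (λ j → h ⟨$⟩ˡ (τ j ⟨$⟩ʳ u)) (τ-injective u ∘ ⟨$⟩ˡ-injective h)
                          (λ j → τ-preserves-image h h-aut j u∈hB) (h ⟨$⟩ˡ y) y∈hB
    ... | j , e = j , ⟨$⟩ˡ-injective h e

    τ-transitive-on-blocks : ∀ {u y} → SameBlock Γ B u y → ∃[ j ] τ j ⟨$⟩ʳ u ≡ y
    τ-transitive-on-blocks (h , h-aut , u∈hB , y∈hB) = τ-transitive-on-image h h-aut u∈hB y∈hB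

  -- For transitive Aut(Γ) and a base point b ∈ B, the block of u is
  -- (mover u)B for an automorphism `mover u` carrying b to u.  Choosing the
  -- least point of each block gives a transversal of the block system.
  module Transversal (vt : VertexTransitive Γ) {b} (b∈B : b ∈ B) where

    mover : Fin n → Perm n
    mover u = proj₁ (vt b u)

    mover-aut : ∀ u → IsAut Γ (mover u)
    mover-aut u = proj₁ (proj₂ (vt b u))

    Blk : Fin n → Fin n → Set
    Blk u = InImage (mover u) B

    Blk? : ∀ u y → Dec (Blk u y)
    Blk? u y = mover u ⟨$⟩ˡ y ∈? B

    Blk-refl : ∀ u → Blk u u
    Blk-refl u = subst (λ w → mover u ⟨$⟩ˡ w ∈ B) (proj₂ (proj₂ (vt b u)))
                       (subst (_∈ B) (sym (inverseˡ (mover u))) b∈B)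

    Blk-trans : ∀ {u v w} → Blk u v → Blk v w → Blk u w
    Blk-trans {u} {v} uv vw =
      images-coincide (mover v) (mover u) (mover-aut v) (mover-aut u) (Blk-refl v) uv vw

    Blk-sym : ∀ {u v} → Blk u v → Blk v u
    Blk-sym {u} {v} uv =
      images-coincide (mover u) (mover v) (mover-aut u) (mover-aut v) uv (Blk-refl v) (Blk-refl u)

    Blk⇒SameBlock : ∀ {u y} → Blk u y → SameBlock Γ B u y
    Blk⇒SameBlock {u} uy = mover u , mover-aut u , Blk-refl u , uy

    IsLeast : Fin n → Set
    IsLeast x = ∀ y → Blk x y → x F.≤ y

    IsLeast? : Decidable IsLeast
    IsLeast? x = all? (λ y → Blk? x y →-dec x ≤ᶠ? y)

    least-of-block : ∀ u → ∃[ x ] (Blk u x × IsLeast x)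
    least-of-block u
      with ¬∀⟶∃¬-smallest n (λ y → ¬ Blk u y) (λ y → ¬? (Blk? u y)) (λ none → none u (Blk-refl u))
    ... | x , ¬¬ux , none-below = x , ux , x-least
      where
      ux : Blk u x
      ux = decidable-stable (Blk? u x) ¬¬ux
      x-least : IsLeast x
      x-least y xy with x ≤ᶠ? y
      ... | yes x≤y = x≤y
      ... | no  x≰y = contradiction (Blk-trans ux xy)
                        (subst (λ z → ¬ Blk u z) below≡y (none-below (fromℕ< y<x)))
        where
        y<x = ≰⇒> x≰y
        below≡y : inject (fromℕ< y<x) ≡ y
        below≡y = toℕ-injective (trans (toℕ-inject (fromℕ< y<x)) (toℕ-fromℕ< y<x))

    least-unique : ∀ {x x′} → IsLeast x → IsLeast x′ → Blk x x′ → x ≡ x′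
    least-unique x-least x′-least xx′ = ≤ᶠ-antisym (x-least _ xx′) (x′-least _ (Blk-sym xx′))

    Reps : Subset n
    Reps = select IsLeast?

module Factorization {n} (Γ : Graph n) (B : Subset n) (blk : IsBlock Γ B)
                     (vt : VertexTransitive Γ) {b} (b∈B : b ∈ B)
                     (τ : Fin ∣ B ∣ → Perm n) (τ-fix : ∀ j → InFixer Γ B (τ j))
                     (τ-orth : ∀ i j → i ≢ j → Orthogonal (τ i) (τ j)) where

  open Blocks Γ B blk
  open OrthogonalFixerFamily τ τ-fix τ-orth
  open Transversal vt b∈B

  τ-stays-in-block : ∀ x j → Blk x (τ j ⟨$⟩ʳ x)
  τ-stays-in-block x j = τ-preserves-image (mover x) (mover-aut x) j (Blk-refl x)

  rep : Fin n → Fin n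
  rep u = proj₁ (least-of-block u)

  rep∈Reps : ∀ u → rep u ∈ Reps
  rep∈Reps u = select-complete IsLeast? (proj₂ (proj₂ (least-of-block u)))

  coordinate : ∀ u → ∃[ j ] τ j ⟨$⟩ʳ rep u ≡ u
  coordinate u = τ-transitive-on-image (mover (rep u)) (mover-aut (rep u)) (Blk-refl (rep u))
                                       (Blk-sym (proj₁ (proj₂ (least-of-block u))))

  block-count : ℕ
  block-count = ∣ Reps ∣

  position : Fin n → Fin (block-count * ∣ B ∣)
  position u = combine (rank Reps (rep u) (rep∈Reps u)) (proj₁ (coordinate u))

  position-injective : Injective _≡_ _≡_ position
  position-injective {u} {u′} e with combine-injective _ _ _ _ e
  ... | same-rank , same-coordinate = begin
    u                                      ≡⟨ sym (proj₂ (coordinate u)) ⟩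
    τ (proj₁ (coordinate u)) ⟨$⟩ʳ rep u    ≡⟨ cong₂ (λ j x → τ j ⟨$⟩ʳ x) same-coordinate
                                                    (rank-injective Reps same-rank) ⟩
    τ (proj₁ (coordinate u′)) ⟨$⟩ʳ rep u′  ≡⟨ proj₂ (coordinate u′) ⟩
    u′                                     ∎
    where open ≡-Reasoning

  -- … and so is (r, j) ↦ τⱼ(xᵣ): distinct representatives lie in distinct blocks.
  points : Fin block-count → Fin ∣ B ∣ → Fin n
  points r j = τ j ⟨$⟩ʳ unrank Reps r

  points-injective : Injective₂ points
  points-injective {r} {j} {r′} {j′} e =
    unrank-injective Reps x≡x′ , τ-injective x (trans e (cong (τ j′ ⟨$⟩ʳ_) (sym x≡x′)))
    where
    x = unrank Reps r
    x′ = unrank Reps r′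
    same-block : Blk x x′
    same-block = Blk-trans (subst (Blk x) e (τ-stays-in-block x j))
                           (Blk-sym (τ-stays-in-block x′ j′))
    x≡x′ : x ≡ x′
    x≡x′ = least-unique (select-sound IsLeast? (unrank-∈ Reps r))
                        (select-sound IsLeast? (unrank-∈ Reps r′)) same-block

  vertex-count : block-count * ∣ B ∣ ≡ n
  vertex-count = sym (cantor-schröder-bernstein position-injective (flatten-injective points-injective))

  -- Given g₁,…,gₘ permuting the blocks sharply transitively, the
  -- automorphisms σᵢⱼ = gᵢ ∘ τⱼ (τⱼ applied first) sum to J.
  uniformly-vertex-transitive : ∀ m → m * ∣ B ∣ ≡ n → QuotientUniformlyTransitive Γ B m →
                                UniformlyVertexTransitive Γ
  uniformly-vertex-transitive m mk≡n (g , g-aut , _ , g-sharp) =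
    uvt-from-product Γ σ mk≡n σ-aut σ-onto σ-injective
    where
    σ : Fin m → Fin ∣ B ∣ → Perm n
    σ i j = τ j ∘ₚ g i

    σ-aut : ∀ i j → IsAut Γ (σ i j)
    σ-aut i j = IsAut-∘ (τ j) (g i) (proj₁ (τ-fix j)) (g-aut i)

    σ-in-block-of-g : ∀ u i j → SameBlock Γ B (g i ⟨$⟩ʳ u) (σ i j ⟨$⟩ʳ u)
    σ-in-block-of-g u i j = sameBlock-transport (g i) (g-aut i) (Blk⇒SameBlock (τ-stays-in-block u j))

    -- i is the index with v in the block gᵢ(block of u), and j the index
    -- with τⱼ(u) = gᵢ⁻¹(v).
    σ-onto : ∀ u v → ∃[ i ] ∃[ j ] σ i j ⟨$⟩ʳ u ≡ v
    σ-onto u v with g-sharp u v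
    ... | i , giu~v , _ with τ-transitive-on-blocks pulled-back
      where
      pulled-back : SameBlock Γ B u (g i ⟨$⟩ˡ v)
      pulled-back = subst (λ w → SameBlock Γ B w (g i ⟨$⟩ˡ v)) (inverseˡ (g i))
                          (sameBlock-transport (flip (g i)) (IsAut-flip (g i) (g-aut i)) giu~v)
    ... | j , τju≡ = i , j , trans (cong (g i ⟨$⟩ʳ_) τju≡) (inverseʳ (g i))

    -- σᵢⱼ(u) lies in the block gᵢ(block of u), which determines i; then j
    -- is determined by orthogonality.
    σ-injective : ∀ u → Injective₂ (λ i j → σ i j ⟨$⟩ʳ u)
    σ-injective u {i} {j} {i′} {j′} e with g-sharp u (σ i j ⟨$⟩ʳ u)
    ... | _ , _ , only
      with trans (only i (σ-in-block-of-g u i j))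
                 (sym (only i′ (subst (SameBlock Γ B (g i′ ⟨$⟩ʳ u)) (sym e)
                                      (σ-in-block-of-g u i′ j′))))
    ... | refl = refl , τ-injective u (⟨$⟩ʳ-injective (g i) e)

theorem4p5 : (n : ℕ) (Γ : Graph n) → Imprimitive Γ →
    ∃[ B ] IsFactorizing Γ B → UniformlyVertexTransitive Γ
theorem4p5 n Γ (vt , _) (B , blk , (1<|B| , _) , (τ , τ-fix , τ-orth) , quotient-sharp) =
  uniformly-vertex-transitive block-count vertex-count (quotient-sharp block-count vertex-count)
  where
  b∈B : unrank B (fromℕ< (<⇒≤ 1<|B|)) ∈ B
  b∈B = unrank-∈ B (fromℕ< (<⇒≤ 1<|B|))
  open Factorization Γ B blk vt b∈B τ τ-fix τ-orth
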